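{- For $n\ge3$ and $n>m\ge0$, the numbers $e_{n,m}$ satisfy $L_e\le e_{n,m}\le U_e$, where \[ L_e=\frac{n-m+2}{n+m}e_{n-1,m-1}+\frac{n-m-2}{n-m}e_{n-1,m+1}+\frac{n-m-4}{n-m-2}\left(\frac{2}{n-m}e_{n-2,m+2}+\frac{2}{n+m}e_{n-3,m+1}\right), \] \[ U_e=\frac{n-m+2}{n+m}e_{n-1,m-1}+\frac{n-m-2}{n-m}e_{n-1,m+1}+\frac{2}{n-m}e_{n-2,m+2}+\frac{2}{n+m}e_{n-3,m+1}+\frac{4}{(n+m)(n+m-2)}e_{n-3,m-1}. \] Furthermore $U_e\le U_d\le d_{n,m}$, where $U_d$ is the same expression as $U_e$ with every $e$ replaced by $d$.
   Context: Let $c_{a,b}$ be defined by $c_{a,b}=c_{a,b-1}+(b+1)c_{a-1,b}-(b-1)c_{a-2,b-1}$ for $a\ge b\ge1$, $c_{a,b}=0$ for $a<b$, $c_{a,0}=1$ for $a\ge0$ (it counts C-decorated paths ending at $(a,b)$, and $c_{a,a}$ is the number of compacted binary trees of size $a$). For integers $n,m\ge0$ with $n-m$ even put $e_{n,m}=c_{(n+m)/2,(n-m)/2}/((n+m)/2)!$, and put $e_{n,m}=0$ if $n-m$ is odd or $m=-1$. Let $d_{n,m}$ be defined by $d_{n,m}=\frac{n-m+2}{n+m}d_{n-1,m-1}+d_{n-1,m+1}$ for $n>0,m\ge0$, $d_{0,m}=0$ for $m>0$, $d_{n,-1}=0$ for $n\ge0$, $d_{0,0}=1$. -}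

module Defs where

open import Data.Bool using (Bool; true; false; if_then_else_)
open import Data.Nat as ℕ using (ℕ; zero; suc; _∸_; _<ᵇ_; _≡ᵇ_; _%_; ⌊_/2⌋)
open import Data.Nat using (_!)
open import Data.Integer as ℤ using (ℤ; +_; -[1+_])
open import Data.Rational as ℚ using (ℚ; 0ℚ; 1ℚ)

-- c_{a,b} (integer valued because of the subtraction in the recurrence).
-- The term c_{a-2,b-1} with a-2 = -1 only occurs for a = b = 1, where its
-- coefficient (b-1) is 0; we take it to be 0.
c : ℕ → ℕ → ℤ
c a zero = + 1
c zero (suc b) = + 0
c (suc zero) (suc b) =
  if 1 <ᵇ suc b then + 0
  else (c 1 b ℤ.+ (+ (2 ℕ.+ b)) ℤ.* c 0 (suc b) ℤ.- (+ b) ℤ.* (+ 0))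
c (suc (suc a)) (suc b) =
  if suc (suc a) <ᵇ suc b then + 0
  else (c (suc (suc a)) b ℤ.+ (+ (2 ℕ.+ b)) ℤ.* c (suc a) (suc b) ℤ.- (+ b) ℤ.* c a b)

-- total division of integers into ℚ: fr p q = p / q, and 0 when q = 0
fr : ℤ → ℤ → ℚ
fr p (+ zero) = 0ℚ
fr p (+ suc k) = p ℚ./ suc k
fr p (-[1+ k ]) = (ℤ.- p) ℚ./ suc k

e : ℕ → ℕ → ℚ
e n m =
  if n <ᵇ m then 0ℚ
  else (if ((n ℕ.+ m) % 2) ≡ᵇ 0
        then fr (c ⌊ n ℕ.+ m /2⌋ ⌊ n ∸ m /2⌋) (+ (⌊ n ℕ.+ m /2⌋ !))
        else 0ℚ)

-- eM n m = e_{n,m-1}, with e_{n,-1} = 0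
eM : ℕ → ℕ → ℚ
eM n zero = 0ℚ
eM n (suc m) = e n m

-- d_{n,m}, and dM n m = d_{n,m-1} with d_{n,-1} = 0
d  : ℕ → ℕ → ℚ
dM : ℕ → ℕ → ℚ
d zero zero = 1ℚ
d zero (suc m) = 0ℚ
d (suc n) m =
  fr ((+ suc n) ℤ.- (+ m) ℤ.+ (+ 2)) ((+ suc n) ℤ.+ (+ m)) ℚ.* dM n m ℚ.+ d n (suc m)
dM n zero = 0ℚ
dM n (suc m) = d n m

-- U(f) from the statement; f is e or d, fM the corresponding "m-1" version.
U : (ℕ → ℕ → ℚ) → (ℕ → ℕ → ℚ) → ℕ → ℕ → ℚ
U f fM n m =
  fr (N ℤ.- M ℤ.+ + 2) (N ℤ.+ M) ℚ.* fM (n ∸ 1) m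
  ℚ.+ fr (N ℤ.- M ℤ.- + 2) (N ℤ.- M) ℚ.* f (n ∸ 1) (suc m)
  ℚ.+ fr (+ 2) (N ℤ.- M) ℚ.* f (n ∸ 2) (suc (suc m))
  ℚ.+ fr (+ 2) (N ℤ.+ M) ℚ.* f (n ∸ 3) (suc m)
  ℚ.+ fr (+ 4) ((N ℤ.+ M) ℤ.* (N ℤ.+ M ℤ.- + 2)) ℚ.* fM (n ∸ 3) m
  where
  N = + n
  M = + m

Le : ℕ → ℕ → ℚ
Le n m =
  fr (N ℤ.- M ℤ.+ + 2) (N ℤ.+ M) ℚ.* eM (n ∸ 1) m
  ℚ.+ fr (N ℤ.- M ℤ.- + 2) (N ℤ.- M) ℚ.* e (n ∸ 1) (suc m)
  ℚ.+ fr (N ℤ.- M ℤ.- + 4) (N ℤ.- M ℤ.- + 2)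
      ℚ.* (fr (+ 2) (N ℤ.- M) ℚ.* e (n ∸ 2) (suc (suc m))
           ℚ.+ fr (+ 2) (N ℤ.+ M) ℚ.* e (n ∸ 3) (suc m))
  where
  N = + n
  M = + m

Ue : ℕ → ℕ → ℚ
Ue = U e eM

Ud : ℕ → ℕ → ℚ
Ud = U d dM

module Submission where

-- For an integer array f write value f n m for f_{(n+m)/2,(n-m)/2}/((n+m)/2)!
-- when n - m ≥ 0 is even, and 0 otherwise; so e = value c.  Let c⁺ satisfy the
-- recurrence of c without its subtracted term.  The recurrence of d is exactly
-- the recurrence of value c⁺, hence d = value c⁺.
--
-- If n - m is odd, every point occurring in the lemma has odd coordinate sum
-- and all five quantities are 0.  If n - m = 2(β+1) with (n+m)/2 = α+2, then
-- e, d, U_e and U_d are single fractions over (α+2)!(β+1), and L_e over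
-- (α+2)!(β+1)β when β > 0.  The four inequalities then reduce to inequalities
-- between integer numerators, which follow from the recurrence of c together
-- with c ≥ 0, b c_{a,b} ≤ c_{a+1,b}, b c_{a-1,b} ≤ c_{a,b+1} and c ≤ c⁺; each
-- is proved by writing the difference as a visibly nonnegative combination.

open import Defs

module Fractions where

  open import Data.Nat as ℕ using (ℕ; suc)
  import Data.Nat.Properties as ℕP
  open import Data.Integer as ℤ using (ℤ; +_; -[1+_])
  import Data.Integer.Properties as ℤP
  open import Data.Integer.Tactic.RingSolver using (solve-∀)
  open import Data.Rational as ℚ using (ℚ; 0ℚ)
  import Data.Rational.Properties as ℚP
  import Data.Rational.Unnormalised as ℚᵘ
  import Data.Rational.Unnormalised.Properties as ℚᵘP
  open import Data.Product using (Σ; _,_)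
  open import Relation.Binary.PropositionalEquality using (_≡_; refl; sym; trans; cong)

  -- A positive integer, presented so that `fr` computes on it.
  IsPos : ℤ → Set
  IsPos q = Σ ℕ λ k → q ≡ + suc k

  pos-* : ∀ {q r} → IsPos q → IsPos r → IsPos (q ℤ.* r)
  pos-* (k , refl) (l , refl) = l ℕ.+ k ℕ.* suc l , refl

  nonzero-pos : ∀ n .{{_ : ℕ.NonZero n}} → IsPos (+ n)
  nonzero-pos n = ℕ.pred n , cong +_ (sym (ℕP.suc-pred n))

  private
    fr-toℚᵘ : ∀ p k → ℚ.toℚᵘ (fr p (+ suc k)) ℚᵘ.≃ ℚᵘ.mkℚᵘ p k
    fr-toℚᵘ p k = ℚP.toℚᵘ-fromℚᵘ (ℚᵘ.mkℚᵘ p k)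

  fr-cross : ∀ {p q r s} → IsPos q → IsPos s → p ℤ.* s ≡ r ℤ.* q → fr p q ≡ fr r s
  fr-cross {p} {_} {r} (k , refl) (l , refl) eq =
    ℚP.fromℚᵘ-cong {ℚᵘ.mkℚᵘ p k} {ℚᵘ.mkℚᵘ r l} (ℚᵘ.*≡* eq)

  fr-* : ∀ {p q x r} → IsPos q → IsPos r → fr p q ℚ.* fr x r ≡ fr (p ℤ.* x) (q ℤ.* r)
  fr-* {p} {_} {x} (k , refl) (l , refl) =
    ℚP.toℚᵘ-injective (ℚᵘP.≃-trans (ℚP.toℚᵘ-homo-* (fr p (+ suc k)) (fr x (+ suc l)))
      (ℚᵘP.≃-trans (ℚᵘP.*-cong (fr-toℚᵘ p k) (fr-toℚᵘ x l)) (ℚᵘP.≃-sym (fr-toℚᵘ (p ℤ.* x) _))))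

  fr-+ : ∀ {p q r} → IsPos q → fr p q ℚ.+ fr r q ≡ fr (p ℤ.+ r) q
  fr-+ {p} {_} {r} (k , refl) =
    ℚP.toℚᵘ-injective (ℚᵘP.≃-trans (ℚP.toℚᵘ-homo-+ (fr p (+ suc k)) (fr r (+ suc k)))
      (ℚᵘP.≃-trans (ℚᵘP.+-cong (fr-toℚᵘ p k) (fr-toℚᵘ r k))
        (ℚᵘP.≃-trans (ℚᵘ.*≡* (common-denominator p r (+ suc k))) (ℚᵘP.≃-sym (fr-toℚᵘ (p ℤ.+ r) _)))))
    where
    common-denominator : ∀ p r d → (p ℤ.* d ℤ.+ r ℤ.* d) ℤ.* d ≡ (p ℤ.+ r) ℤ.* (d ℤ.* d)
    common-denominator = solve-∀

  fr-mono-≤ : ∀ {p q r} → IsPos q → p ℤ.≤ r → fr p q ℚ.≤ fr r q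
  fr-mono-≤ {p} {_} {r} (k , refl) p≤r =
    ℚP.toℚᵘ-cancel-≤ (ℚᵘP.≤-respˡ-≃ (ℚᵘP.≃-sym (fr-toℚᵘ p k)) (ℚᵘP.≤-respʳ-≃ (ℚᵘP.≃-sym (fr-toℚᵘ r k))
      (ℚᵘ.*≤* (ℤP.*-monoʳ-≤-nonNeg (+ suc k) p≤r))))

  fr-zero : ∀ q → fr (+ 0) q ≡ 0ℚ
  fr-zero (+ 0) = refl
  fr-zero (+ suc k) = ℚP.0/n≡0 (suc k)
  fr-zero -[1+ k ] = ℚP.0/n≡0 (suc k)

  fr-*-over : ∀ p q x r y D → IsPos q → IsPos r → IsPos D →
    p ℤ.* x ℤ.* D ≡ y ℤ.* (q ℤ.* r) → fr p q ℚ.* fr x r ≡ fr y D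
  fr-*-over _ _ _ _ _ _ q>0 r>0 D>0 eq = trans (fr-* q>0 r>0) (fr-cross (pos-* q>0 r>0) D>0 eq)

  fr-scale : ∀ p {q} → IsPos q → ∀ k → fr p q ≡ fr (p ℤ.* + suc k) (q ℤ.* + suc k)
  fr-scale p {q} q>0 k = fr-cross q>0 (pos-* q>0 (k , refl)) (identity p q (+ suc k))
    where
    identity : ∀ p q s → p ℤ.* (q ℤ.* s) ≡ p ℤ.* s ℤ.* q
    identity = solve-∀

module Certificates where

  open import Data.Nat as ℕ using (ℕ)
  open import Data.Integer using (ℤ; +_; _+_; _-_; _*_; _≤_; 0ℤ; +≤+)
  import Data.Integer.Properties as ℤP
  open import Data.Product using (Σ; _,_)
  open import Relation.Binary.PropositionalEquality using (_≡_; refl; sym; subst)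

  -- Inequalities between integers are proved by exhibiting the difference
  -- as a visibly nonnegative expression: a sum of products of naturals.
  Nonneg : ℤ → Set
  Nonneg x = Σ ℕ λ k → x ≡ + k

  nonneg-nat : ∀ k → Nonneg (+ k)
  nonneg-nat k = k , refl

  nonneg-+ : ∀ {x y} → Nonneg x → Nonneg y → Nonneg (x + y)
  nonneg-+ (k , refl) (l , refl) = k ℕ.+ l , refl

  nonneg-* : ∀ {x y} → Nonneg x → Nonneg y → Nonneg (x * y)
  nonneg-* (k , refl) (l , refl) = k ℕ.* l , sym (ℤP.pos-* k l)

  nonneg-≥0 : ∀ {x} → 0ℤ ≤ x → Nonneg x
  nonneg-≥0 0≤x = _ , sym (ℤP.0≤i⇒+∣i∣≡i 0≤x)

  nonneg-gap : ∀ {x y} → x ≤ y → Nonneg (y - x)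
  nonneg-gap x≤y = nonneg-≥0 (ℤP.i≤j⇒0≤j-i x≤y)

  ≥0-nonneg : ∀ {x} → Nonneg x → 0ℤ ≤ x
  ≥0-nonneg (k , refl) = +≤+ ℕ.z≤n

  ≤-by : ∀ {x y} r → Nonneg r → y - x ≡ r → x ≤ y
  ≤-by r r≥0 eq = ℤP.0≤i-j⇒j≤i (subst (0ℤ ≤_) (sym eq) (≥0-nonneg r≥0))

module CArray where

  open Certificates
  open import Data.Bool using (true; false; if_then_else_)
  open import Data.Bool.Properties using (T-≡)
  open import Data.Nat as ℕ using (ℕ; zero; suc; _<ᵇ_; z≤n; s≤s)
  import Data.Nat.Properties as ℕP
  open import Data.Integer as ℤ using (ℤ; +_; _+_; _-_; _*_; _≤_; 0ℤ; +≤+)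
  import Data.Integer.Properties as ℤP
  open import Data.Integer.Tactic.RingSolver using (solve-∀)
  open import Data.Product using (_×_; _,_; proj₁; proj₂)
  open import Data.Sum using (inj₁; inj₂)
  open import Function using (Equivalence; _$_)
  open import Relation.Binary.Definitions using (tri<; tri≈; tri>)
  open import Relation.Binary.PropositionalEquality
  open import Relation.Nullary using (yes; no)

  <ᵇ-false : ∀ a b → b ℕ.≤ a → (a <ᵇ b) ≡ false
  <ᵇ-false a zero _ = refl
  <ᵇ-false (suc a) (suc b) (s≤s b≤a) = <ᵇ-false a b b≤a

  <ᵇ-true : ∀ {a b} → a ℕ.< b → (a <ᵇ b) ≡ true
  <ᵇ-true a<b = Equivalence.to T-≡ (ℕP.<⇒<ᵇ a<b)

  c-first-column : ∀ a → c a 0 ≡ + 1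
  c-first-column zero = refl
  c-first-column (suc zero) = refl
  c-first-column (suc (suc a)) = refl

  -- c_{a-1,b}, with the value 0 at a = 0 (its coefficient vanishes there anyway).
  c-prev : ℕ → ℕ → ℤ
  c-prev zero b = + 0
  c-prev (suc a) b = c a b

  c-rec : ∀ a b → b ℕ.≤ a →
    c (suc a) (suc b) ≡ c (suc a) b + + (2 ℕ.+ b) * c a (suc b) - + b * c-prev a b
  c-rec zero zero _ = refl
  c-rec (suc a) b b≤a rewrite <ᵇ-false (suc a) b b≤a = refl

  c-above : ∀ a b → a ℕ.< b → c a b ≡ + 0
  c-above zero (suc b) _ = refl
  c-above (suc zero) (suc b) (s≤s a<b) rewrite <ᵇ-true a<b = refl
  c-above (suc (suc a)) (suc b) (s≤s a<b) rewrite <ᵇ-true a<b = refl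

  c-prev-above : ∀ a b → a ℕ.≤ b → c-prev a b ≡ + 0
  c-prev-above zero b _ = refl
  c-prev-above (suc a) b a<b = c-above a b a<b

  c-diag : ∀ k → c (suc k) (suc k) ≡ c (suc k) k
  c-diag k = begin
    c (suc k) (suc k)
      ≡⟨ c-rec k k ℕP.≤-refl ⟩
    c (suc k) k + + (2 ℕ.+ k) * c k (suc k) - + k * c-prev k k
      ≡⟨ cong₂ (λ u v → c (suc k) k + + (2 ℕ.+ k) * u - + k * v)
               (c-above k (suc k) ℕP.≤-refl) (c-prev-above k k ℕP.≤-refl) ⟩
    c (suc k) k + + (2 ℕ.+ k) * + 0 - + k * + 0
      ≡⟨ drop-zeros (c (suc k) k) (+ (2 ℕ.+ k)) (+ k) ⟩
    c (suc k) k ∎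
    where
    open ≡-Reasoning
    drop-zeros : ∀ x y z → x + y * + 0 - z * + 0 ≡ x
    drop-zeros = solve-∀

  Growth : ℕ → ℕ → Set
  Growth a b = c (suc a) b + + suc b * c a b ≤ c (suc a) (suc b)

  -- Nonnegativity and growth are proved together, row by row.
  private
    NonnegRow : ℕ → Set
    NonnegRow a = ∀ b → 0ℤ ≤ c a b

    GrowthRow : ℕ → Set
    GrowthRow a = ∀ b → b ℕ.< a → Growth a b

    nonneg-step : ∀ a → NonnegRow a → GrowthRow a → NonnegRow (suc a)
    nonneg-step a row≥0 grow zero = +≤+ z≤n
    nonneg-step a row≥0 grow (suc b) with ℕP.<-cmp b a
    ... | tri< b<a _ _ = ℤP.≤-trans
            (≥0-nonneg (nonneg-+ (nonneg-≥0 (nonneg-step a row≥0 grow b))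
                                 (nonneg-* (nonneg-nat (suc b)) (nonneg-≥0 (row≥0 b)))))
            (grow b b<a)
    ... | tri≈ _ refl _ = subst (0ℤ ≤_) (sym (c-diag b)) (nonneg-step a row≥0 grow b)
    ... | tri> _ _ b>a = subst (0ℤ ≤_) (sym (c-above (suc a) (suc b) (s≤s b>a))) (+≤+ z≤n)

    growth-below : ∀ a b → b ℕ.< a → NonnegRow a → NonnegRow (suc a) → Growth a b → Growth (suc a) b
    growth-below a b b<a row≥0 row'≥0 g
      rewrite c-rec (suc a) b (ℕP.m≤n⇒m≤1+n (ℕP.<⇒≤ b<a)) =
      ≤-by ((+ 2 + + b) * (R - (P + (+ 1 + + b) * Q)) + P + (+ b * + b + + 2 * + b + + 2) * Q)
        (nonneg-+ (nonneg-+ (nonneg-* (nonneg-nat (2 ℕ.+ b)) (nonneg-gap g)) (nonneg-≥0 (row'≥0 b)))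
                  (nonneg-* b²+2b+2≥0 (nonneg-≥0 (row≥0 b))))
        (certificate (c (suc (suc a)) b) R P Q (+ b))
      where
      b²+2b+2≥0 = nonneg-+ (nonneg-+ (nonneg-* (nonneg-nat b) (nonneg-nat b))
                                     (nonneg-* (nonneg-nat 2) (nonneg-nat b))) (nonneg-nat 2)
      R = c (suc a) (suc b)
      P = c (suc a) b
      Q = c a b
      certificate : ∀ X R P Q B →
        X + (+ 2 + B) * R - B * Q - (X + (+ 1 + B) * P)
          ≡ (+ 2 + B) * (R - (P + (+ 1 + B) * Q)) + P + (B * B + + 2 * B + + 2) * Q
      certificate = solve-∀

    row-subdiagonal : ∀ a → NonnegRow (suc a) → GrowthRow a → + a * c a a ≤ c (suc a) a
    row-subdiagonal zero _ _ = +≤+ z≤n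
    row-subdiagonal (suc a) row'≥0 grow =
      subst (λ u → + suc a * u ≤ c (suc (suc a)) (suc a)) (sym (c-diag a)) $
      ℤP.≤-trans (ℤP.i≤j+i _ _ {{ℤ.nonNegative (row'≥0 a)}}) (grow a ℕP.≤-refl)

    growth-diag : ∀ a → NonnegRow (suc a) → GrowthRow a → Growth (suc a) a
    growth-diag a row'≥0 grow =
      subst (X + + suc a * P ≤_) (sym unfold)
        (≤-by (P - + a * Q) (nonneg-gap (row-subdiagonal a row'≥0 grow)) (certificate X P Q (+ a)))
      where
      X = c (suc (suc a)) a
      P = c (suc a) a
      Q = c a a
      unfold : c (suc (suc a)) (suc a) ≡ X + + (2 ℕ.+ a) * P - + a * Q
      unfold = trans (c-rec (suc a) a (ℕP.n≤1+n a))
                     (cong (λ u → X + + (2 ℕ.+ a) * u - + a * Q) (c-diag a))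
      certificate : ∀ X P Q A →
        X + (+ 2 + A) * P - A * Q - (X + (+ 1 + A) * P) ≡ P - A * Q
      certificate = solve-∀

    rows : ∀ a → NonnegRow a × GrowthRow a
    rows zero = row₀ , λ _ ()
      where
      row₀ : NonnegRow zero
      row₀ zero = +≤+ z≤n
      row₀ (suc b) = +≤+ z≤n
    rows (suc a) = row'≥0 , grow'
      where
      row'≥0 = nonneg-step a (proj₁ (rows a)) (proj₂ (rows a))
      grow' : GrowthRow (suc a)
      grow' b (s≤s b≤a) with ℕP.m≤n⇒m<n∨m≡n b≤a
      ... | inj₁ b<a = growth-below a b b<a (proj₁ (rows a)) row'≥0 (proj₂ (rows a) b b<a)
      ... | inj₂ refl = growth-diag a row'≥0 (proj₂ (rows a))

  c-nonneg : ∀ a b → 0ℤ ≤ c a b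
  c-nonneg a = proj₁ (rows a)

  c-growth : ∀ a b → b ℕ.< a → Growth a b
  c-growth a = proj₂ (rows a)

  c-prev-nonneg : ∀ a b → 0ℤ ≤ c-prev a b
  c-prev-nonneg zero b = +≤+ z≤n
  c-prev-nonneg (suc a) b = c-nonneg a b

  c-subdiagonal : ∀ a → + a * c a a ≤ c (suc a) a
  c-subdiagonal a = row-subdiagonal a (c-nonneg (suc a)) (c-growth a)

  private
    times-zero-≤ : ∀ b x y → x ≡ + 0 → 0ℤ ≤ y → + b * x ≤ y
    times-zero-≤ b x y x≡0 0≤y = ℤP.≤-trans (ℤP.≤-reflexive (trans (cong (+ b *_) x≡0) (ℤP.*-zeroʳ (+ b)))) 0≤y

  c-weak-growth : ∀ a b → + b * c a b ≤ c (suc a) (suc b)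
  c-weak-growth a b with ℕP.<-cmp b a
  ... | tri< b<a _ _ =
    ℤP.≤-trans (≤-by (c (suc a) b + c a b)
                     (nonneg-+ (nonneg-≥0 (c-nonneg (suc a) b)) (nonneg-≥0 (c-nonneg a b)))
                     (certificate (c (suc a) b) (c a b) (+ b)))
               (c-growth a b b<a)
    where
    certificate : ∀ X Y B → X + (+ 1 + B) * Y - B * Y ≡ X + Y
    certificate = solve-∀
  ... | tri≈ _ refl _ = subst (+ b * c b b ≤_) (sym (c-diag b)) (c-subdiagonal b)
  ... | tri> _ _ b>a = times-zero-≤ b (c a b) _ (c-above a b b>a) (c-nonneg (suc a) (suc b))

  c-weak-growth-prev : ∀ a b → + b * c-prev a b ≤ c a (suc b)
  c-weak-growth-prev zero b = times-zero-≤ b (+ 0) _ refl (c-nonneg zero (suc b))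
  c-weak-growth-prev (suc a) b = c-weak-growth a b

  c-column : ∀ a b → + b * c a b ≤ c (suc a) b
  c-column a zero = +≤+ z≤n
  c-column zero (suc b) = times-zero-≤ (suc b) (+ 0) _ refl (c-nonneg 1 (suc b))
  c-column (suc a) (suc b) with suc b ℕ.≤? suc a
  ... | no b≰a = times-zero-≤ (suc b) _ _ (c-above (suc a) (suc b) (ℕP.≰⇒> b≰a)) (c-nonneg (suc (suc a)) (suc b))
  ... | yes (s≤s b≤a) = subst (+ suc b * c (suc a) (suc b) ≤_) (sym (c-rec (suc a) b (ℕP.m≤n⇒m≤1+n b≤a))) $
    ≤-by (c (suc (suc a)) b + (c (suc a) (suc b) - + b * c a b))
      (nonneg-+ (nonneg-≥0 (c-nonneg (suc (suc a)) b)) (nonneg-gap (c-weak-growth a b)))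
      (certificate (c (suc (suc a)) b) (c (suc a) (suc b)) (c a b) (+ b))
    where
    certificate : ∀ X Y Z B → X + (+ 2 + B) * Y - B * Z - (+ 1 + B) * Y ≡ X + (Y - B * Z)
    certificate = solve-∀

  -- The recurrence of c with the subtracted term dropped.  It majorises c and,
  -- as shown later, it is the numerator sequence of d.
  c⁺ : ℕ → ℕ → ℕ
  c⁺ a zero = 1
  c⁺ zero (suc b) = 0
  c⁺ (suc a) (suc b) = if suc a <ᵇ suc b then 0 else c⁺ (suc a) b ℕ.+ (2 ℕ.+ b) ℕ.* c⁺ a (suc b)

  c⁺ℤ : ℕ → ℕ → ℤ
  c⁺ℤ a b = + c⁺ a b

  c⁺ℤ-rec : ∀ a b → b ℕ.≤ a → c⁺ℤ (suc a) (suc b) ≡ c⁺ℤ (suc a) b + + (2 ℕ.+ b) * c⁺ℤ a (suc b)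
  c⁺ℤ-rec a b b≤a rewrite <ᵇ-false a b b≤a =
    trans (ℤP.pos-+ (c⁺ (suc a) b) _) (cong (λ u → c⁺ℤ (suc a) b + u) (ℤP.pos-* (2 ℕ.+ b) (c⁺ a (suc b))))

  c⁺ℤ-above : ∀ a b → a ℕ.< b → c⁺ℤ a b ≡ + 0
  c⁺ℤ-above zero (suc b) _ = refl
  c⁺ℤ-above (suc a) (suc b) (s≤s a<b) rewrite <ᵇ-true a<b = refl

  c≤c⁺ : ∀ a b → c a b ≤ c⁺ℤ a b
  c≤c⁺ a zero = ℤP.≤-refl
  c≤c⁺ zero (suc b) = ℤP.≤-refl
  c≤c⁺ (suc a) (suc b) with b ℕ.≤? a
  ... | no b≰a = ℤP.≤-reflexive (trans (c-above (suc a) (suc b) a<b) (sym (c⁺ℤ-above (suc a) (suc b) a<b)))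
    where a<b = s≤s (ℕP.≰⇒> b≰a)
  ... | yes b≤a = subst₂ _≤_ (sym (c-rec a b b≤a)) (sym (c⁺ℤ-rec a b b≤a)) $
    ≤-by ((c⁺ℤ (suc a) b - c (suc a) b) + + (2 ℕ.+ b) * (c⁺ℤ a (suc b) - c a (suc b)) + + b * c-prev a b)
      (nonneg-+ (nonneg-+ (nonneg-gap (c≤c⁺ (suc a) b))
                          (nonneg-* (nonneg-nat (2 ℕ.+ b)) (nonneg-gap (c≤c⁺ a (suc b)))))
                (nonneg-* (nonneg-nat b) (nonneg-≥0 (c-prev-nonneg a b))))
      (certificate (c⁺ℤ (suc a) b) (c⁺ℤ a (suc b)) (c (suc a) b) (c a (suc b)) (c-prev a b) (+ b))
    where
    certificate : ∀ X⁺ Y⁺ X Y Z B →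
      X⁺ + (+ 2 + B) * Y⁺ - (X + (+ 2 + B) * Y - B * Z) ≡ (X⁺ - X) + (+ 2 + B) * (Y⁺ - Y) + B * Z
    certificate = solve-∀

module Values where

  open Fractions
  open CArray using (<ᵇ-false; <ᵇ-true)
  open import Data.Bool using (true; false; if_then_else_)
  open import Data.Nat as ℕ using (ℕ; zero; suc; _+_; _∸_; _<ᵇ_; _≡ᵇ_; _%_; ⌊_/2⌋; _!; _<_; s≤s; z≤n)
  import Data.Nat.Properties as ℕP
  import Data.Nat.DivMod as ℕD
  open import Data.Nat.Tactic.RingSolver using (solve-∀)
  open import Data.Integer as ℤ using (ℤ; +_)
  import Data.Integer.Properties as ℤP
  open import Data.Rational using (ℚ; 0ℚ)
  open import Relation.Binary.PropositionalEquality

  value : (ℕ → ℕ → ℤ) → ℕ → ℕ → ℚ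
  value f n m =
    if n <ᵇ m then 0ℚ
    else (if ((n + m) % 2) ≡ᵇ 0
          then fr (f ⌊ n + m /2⌋ ⌊ n ∸ m /2⌋) (+ (⌊ n + m /2⌋ !))
          else 0ℚ)

  value₋ : (ℕ → ℕ → ℤ) → ℕ → ℕ → ℚ
  value₋ f n zero = 0ℚ
  value₋ f n (suc m) = value f n m

  Vanishing : (ℕ → ℕ → ℤ) → Set
  Vanishing f = ∀ a b → a < b → f a b ≡ + 0

  fact-pos : ∀ n → IsPos (+ (n !))
  fact-pos n = nonzero-pos (n !) {{ℕP._!≢0 n}}

  fact-suc : ∀ a → + (suc a !) ≡ + suc a ℤ.* + (a !)
  fact-suc a = ℤP.pos-* (suc a) (a !)

  private
    double : ∀ j → j + j ≡ j ℕ.* 2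
    double = solve-∀

    half-double : ∀ j → ⌊ j + j /2⌋ ≡ j
    half-double zero = refl
    half-double (suc j) rewrite ℕP.+-suc j j = cong suc (half-double j)

    even-double : ∀ j → (j + j) % 2 ≡ 0
    even-double j = trans (cong (_% 2) (double j)) (ℕD.m*n%n≡0 j 2)

    sum-eq : ∀ k j → k + (j + j) + k ≡ (k + j) + (k + j)
    sum-eq = solve-∀

    parity-shift : ∀ x s N → x + (s + s) ≡ N → x % 2 ≡ N % 2
    parity-shift x s N eq =
      trans (sym (ℕD.[m+kn]%n≡m%n x s 2)) (cong (_% 2) (trans (cong (λ u → x + u) (sym (double s))) eq))

  value-at : ∀ f k j → value f (k + (j + j)) k ≡ fr (f (k + j) j) (+ ((k + j) !))
  value-at f k j
    rewrite <ᵇ-false (k + (j + j)) k (ℕP.m≤m+n k (j + j))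
          | sum-eq k j | even-double (k + j) | half-double (k + j) | ℕP.m+n∸m≡n k (j + j) | half-double j = refl

  value-above : ∀ f {x y} → x < y → value f x y ≡ 0ℚ
  value-above f x<y rewrite <ᵇ-true x<y = refl

  value-odd : ∀ f x y s N → x + y + (s + s) ≡ N → N % 2 ≡ 1 → value f x y ≡ 0ℚ
  value-odd f x y s N eq N-odd with x <ᵇ y
  ... | true = refl
  ... | false rewrite parity-shift (x + y) s N eq | N-odd = refl

  value₋-odd : ∀ f x y s N → suc (x + y + (s + s)) ≡ N → N % 2 ≡ 1 → value₋ f x y ≡ 0ℚ
  value₋-odd f x zero s N eq N-odd = refl
  value₋-odd f x (suc y) s N eq N-odd = value-odd f x y (suc s) N (trans (shift x y s) eq) N-odd
    where
    shift : ∀ x y s → x + y + (suc s + suc s) ≡ suc (x + suc y + (s + s))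
    shift = solve-∀

  value-at-point : ∀ f {x y a b} → x ≡ y + (b + b) → y + b ≡ a → value f x y ≡ fr (f a b) (+ (a !))
  value-at-point f {y = y} {b = b} refl refl = value-at f y b

  -- The same for the point (x, y-1); at y = 0 this needs f_{a,a+1} = 0.
  value₋-at-point : ∀ f → Vanishing f → ∀ {x y a b} →
    suc x ≡ y + (b + b) → y + b ≡ suc a → value₋ f x y ≡ fr (f a b) (+ (a !))
  value₋-at-point f f-vanishes {y = zero} {a} refl refl =
    sym (trans (cong (λ u → fr u (+ (a !))) (f-vanishes a (suc a) ℕP.≤-refl)) (fr-zero (+ (a !))))
  value₋-at-point f f-vanishes {y = suc y} x≡ a≡ =
    value-at-point f (ℕP.suc-injective x≡) (ℕP.suc-injective a≡)

  prevcol : (ℕ → ℕ → ℤ) → ℕ → ℕ → ℤ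
  prevcol f a zero = + 0
  prevcol f a (suc b) = f a b

  value-at-prevcol : ∀ f {x y a b} →
    suc (suc x) ≡ y + (b + b) → y + b ≡ suc a → value f x y ≡ fr (prevcol f a b) (+ (a !))
  value-at-prevcol f {x} {y} {a} {zero} x+2≡ _ =
    trans (value-above f (ℕP.≤-trans (ℕP.n≤1+n (suc x)) (ℕP.≤-reflexive (trans x+2≡ (ℕP.+-identityʳ y)))))
          (sym (fr-zero (+ (a !))))
  value-at-prevcol f {x} {y} {a} {suc b} x+2≡ a+1≡ =
    value-at-point f (ℕP.suc-injective (ℕP.suc-injective (trans x+2≡ (shift y b))))
                     (ℕP.suc-injective (trans (sym (ℕP.+-suc y b)) a+1≡))
    where
    shift : ∀ y b → y + (suc b + suc b) ≡ suc (suc (y + (b + b)))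
    shift = solve-∀

  data Position (x y : ℕ) : Set where
    above : x < y → Position x y
    even  : ∀ j → x ≡ y + (j + j) → Position x y
    odd   : ∀ j → x ≡ y + suc (j + j) → Position x y

  position : ∀ x y → Position x y
  position x zero = distance x
    where
    distance : ∀ x → Position x zero
    distance zero = even 0 refl
    distance (suc x) with distance x
    ... | above ()
    ... | even j refl = odd j refl
    ... | odd j refl = even (suc j) (sym (ℕP.+-suc (suc j) j))
  position zero (suc y) = above (s≤s z≤n)
  position (suc x) (suc y) with position x y
  ... | above x<y = above (s≤s x<y)
  ... | even j refl = even j refl
  ... | odd j refl = odd j refl

  odd-distance-parity : ∀ {x m} j → x ≡ m + suc (j + j) → (x + m) % 2 ≡ 1
  odd-distance-parity {x} {m} j eq =
    trans (cong (λ u → (u + m) % 2) eq)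
          (trans (cong (_% 2) (regroup m j)) (ℕD.[m+kn]%n≡m%n 1 (m + j) 2))
    where
    regroup : ∀ m j → m + suc (j + j) + m ≡ 1 + (m + j) ℕ.* 2
    regroup = solve-∀

module DValues where

  open Fractions
  open CArray using (c⁺ℤ; c⁺ℤ-rec; c⁺ℤ-above)
  open Values
  open import Data.Nat as ℕ using (ℕ; zero; suc; _+_; _!; _<_)
  import Data.Nat.Properties as ℕP
  import Data.Nat.Tactic.RingSolver as ℕSolver
  open import Data.Integer as ℤ using (ℤ; +_)
  import Data.Integer.Properties as ℤP
  import Data.Integer.Tactic.RingSolver as ℤSolver
  open import Data.Rational as ℚ using (ℚ; 0ℚ)
  import Data.Rational.Properties as ℚP
  open import Data.Product using (_,_)
  open import Relation.Binary.PropositionalEquality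

  d-coef : ℕ → ℕ → ℚ
  d-coef n m = fr (+ suc n ℤ.- + m ℤ.+ + 2) (+ suc n ℤ.+ + m)

  Step : ℕ → ℕ → Set
  Step n m = d-coef n m ℚ.* value₋ c⁺ℤ n m ℚ.+ value c⁺ℤ n (suc m) ≡ value c⁺ℤ (suc n) m

  private
    all-vanish : ∀ n m → value₋ c⁺ℤ n m ≡ 0ℚ → value c⁺ℤ n (suc m) ≡ 0ℚ → value c⁺ℤ (suc n) m ≡ 0ℚ → Step n m
    all-vanish n m v₋≡0 v≡0 v'≡0 = begin
      d-coef n m ℚ.* value₋ c⁺ℤ n m ℚ.+ value c⁺ℤ n (suc m)
        ≡⟨ cong₂ (λ u v → d-coef n m ℚ.* u ℚ.+ v) v₋≡0 v≡0 ⟩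
      d-coef n m ℚ.* 0ℚ ℚ.+ 0ℚ
        ≡⟨ ℚP.+-identityʳ (d-coef n m ℚ.* 0ℚ) ⟩
      d-coef n m ℚ.* 0ℚ
        ≡⟨ ℚP.*-zeroʳ (d-coef n m) ⟩
      0ℚ
        ≡⟨ sym v'≡0 ⟩
      value c⁺ℤ (suc n) m ∎
      where open ≡-Reasoning

    two-steps : ∀ m i → suc (suc (m + (i + i))) ≡ m + (suc i + suc i)
    two-steps = ℕSolver.solve-∀

    step-above : ∀ n m → suc n < m → Step n m
    step-above n (suc m) (ℕ.s≤s n<m) =
      all-vanish n (suc m) (value-above c⁺ℤ n<m)
                 (value-above c⁺ℤ (ℕP.m<n⇒m<1+n (ℕP.m<n⇒m<1+n n<m)))
                 (value-above c⁺ℤ (ℕ.s≤s n<m))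

    shifted-sum₋ : ∀ n m → suc (n + m + (0 + 0)) ≡ suc n + m
    shifted-sum₋ = ℕSolver.solve-∀

    shifted-sum : ∀ n m → n + suc m + (0 + 0) ≡ suc n + m
    shifted-sum = ℕSolver.solve-∀

    step-odd : ∀ n m j → suc n ≡ m + suc (j + j) → Step n m
    step-odd n m j eq =
      all-vanish n m (value₋-odd c⁺ℤ n m 0 (suc n + m) (shifted-sum₋ n m) N-odd)
                 (value-odd c⁺ℤ n (suc m) 0 (suc n + m) (shifted-sum n m) N-odd)
                 (value-odd c⁺ℤ (suc n) m 0 (suc n + m) (ℕP.+-identityʳ (suc n + m)) N-odd)
      where
      N-odd = odd-distance-parity j eq

    step-diagonal : ∀ n → Step n (suc n)
    step-diagonal n = begin
      d-coef n (suc n) ℚ.* value c⁺ℤ n n ℚ.+ value c⁺ℤ n (suc (suc n))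
        ≡⟨ cong₂ (λ u v → d-coef n (suc n) ℚ.* u ℚ.+ v) (on-diagonal n)
                 (value-above c⁺ℤ (ℕP.m<n⇒m<1+n (ℕP.n<1+n n))) ⟩
      d-coef n (suc n) ℚ.* fr (+ 1) (+ (n !)) ℚ.+ 0ℚ
        ≡⟨ ℚP.+-identityʳ _ ⟩
      d-coef n (suc n) ℚ.* fr (+ 1) (+ (n !))
        ≡⟨ fr-*-over (+ suc n ℤ.- + suc n ℤ.+ + 2) (+ suc n ℤ.+ + suc n) (+ 1) (+ (n !)) (+ 1) (+ (suc n !))
                     (n + suc n , refl) (fact-pos n) (fact-pos (suc n)) cross ⟩
      fr (+ 1) (+ (suc n !))
        ≡⟨ sym (on-diagonal (suc n)) ⟩
      value c⁺ℤ (suc n) (suc n) ∎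
      where
      open ≡-Reasoning
      on-diagonal : ∀ k → value c⁺ℤ k k ≡ fr (+ 1) (+ (k !))
      on-diagonal k = value-at-point c⁺ℤ {k} {k} {k} {0} (sym (ℕP.+-identityʳ k)) (ℕP.+-identityʳ k)
      identity : ∀ S F → (S ℤ.- S ℤ.+ + 2) ℤ.* + 1 ℤ.* (S ℤ.* F) ≡ + 1 ℤ.* ((S ℤ.+ S) ℤ.* F)
      identity = ℤSolver.solve-∀
      cross : (+ suc n ℤ.- + suc n ℤ.+ + 2) ℤ.* + 1 ℤ.* + (suc n !) ≡ + 1 ℤ.* ((+ suc n ℤ.+ + suc n) ℤ.* + (n !))
      cross = trans (cong (λ u → (+ suc n ℤ.- + suc n ℤ.+ + 2) ℤ.* + 1 ℤ.* u) (fact-suc n))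
                    (identity (+ suc n) (+ (n !)))

    -- Below the diagonal at even distance the step is the recurrence of c⁺.
    step-even : ∀ m i → Step (suc (m + (i + i))) m
    step-even m i = begin
      d-coef n m ℚ.* value₋ c⁺ℤ n m ℚ.+ value c⁺ℤ n (suc m)
        ≡⟨ cong₂ (λ u v → d-coef n m ℚ.* u ℚ.+ v)
                 (value₋-at-point c⁺ℤ c⁺ℤ-above {n} {m} {α} {suc i} (two-steps m i) (ℕP.+-suc m i))
                 (value-at-point c⁺ℤ {n} {suc m} {suc α} {i} refl refl) ⟩
      d-coef n m ℚ.* fr y (+ (α !)) ℚ.+ fr x (+ (suc α !))
        ≡⟨ cong (ℚ._+ fr x (+ (suc α !)))
                (fr-*-over (+ suc n ℤ.- + m ℤ.+ + 2) (+ suc n ℤ.+ + m) y (+ (α !)) (+ (2 ℕ.+ i) ℤ.* y) (+ (suc α !))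
                           (n + m , refl) (fact-pos α) (fact-pos (suc α)) cross) ⟩
      fr (+ (2 ℕ.+ i) ℤ.* y) (+ (suc α !)) ℚ.+ fr x (+ (suc α !))
        ≡⟨ fr-+ (fact-pos (suc α)) ⟩
      fr (+ (2 ℕ.+ i) ℤ.* y ℤ.+ x) (+ (suc α !))
        ≡⟨ cong (λ u → fr u (+ (suc α !)))
                (trans (ℤP.+-comm (+ (2 ℕ.+ i) ℤ.* y) x) (sym (c⁺ℤ-rec α i (ℕP.m≤n+m i m)))) ⟩
      fr (c⁺ℤ (suc α) (suc i)) (+ (suc α !))
        ≡⟨ sym (value-at-point c⁺ℤ {suc n} {m} {suc α} {suc i} (two-steps m i) (ℕP.+-suc m i)) ⟩
      value c⁺ℤ (suc n) m ∎
      where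
      open ≡-Reasoning
      n = suc (m + (i + i))
      α = m + i
      y = c⁺ℤ α (suc i)
      x = c⁺ℤ (suc α) i
      identity : ∀ M I y F →
        (+ 2 ℤ.+ (M ℤ.+ (I ℤ.+ I)) ℤ.- M ℤ.+ + 2) ℤ.* y ℤ.* ((+ 1 ℤ.+ (M ℤ.+ I)) ℤ.* F)
          ≡ (+ 2 ℤ.+ I) ℤ.* y ℤ.* ((+ 2 ℤ.+ (M ℤ.+ (I ℤ.+ I)) ℤ.+ M) ℤ.* F)
      identity = ℤSolver.solve-∀
      cross : (+ suc n ℤ.- + m ℤ.+ + 2) ℤ.* y ℤ.* + (suc α !) ≡ + (2 ℕ.+ i) ℤ.* y ℤ.* ((+ suc n ℤ.+ + m) ℤ.* + (α !))
      cross = trans (cong (λ u → (+ suc n ℤ.- + m ℤ.+ + 2) ℤ.* y ℤ.* u) (fact-suc α))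
                    (identity (+ m) (+ i) y (+ (α !)))

  d-value : ∀ n m → d n m ≡ value c⁺ℤ n m
  dM-value : ∀ n m → dM n m ≡ value₋ c⁺ℤ n m
  d-value zero zero = refl
  d-value zero (suc m) = refl
  d-value (suc n) m =
    trans (cong₂ (λ u v → d-coef n m ℚ.* u ℚ.+ v) (dM-value n m) (d-value n (suc m))) (step n m)
    where
    step : ∀ n m → Step n m
    step n m with position (suc n) m
    ... | above n<m = step-above n m n<m
    ... | odd j eq = step-odd n m j eq
    ... | even zero eq = subst (Step n) (trans eq (ℕP.+-identityʳ m)) (step-diagonal n)
    ... | even (suc i) eq = subst (λ k → Step k m) (ℕP.suc-injective (trans (two-steps m i) (sym eq))) (step-even m i)
  dM-value n zero = refl
  dM-value n (suc m) = d-value n m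

module BoundFractions where

  open Fractions
  open Values using (fact-pos; fact-suc)
  open import Data.Nat as ℕ using (ℕ; zero; suc; _!)
  open import Data.Integer as ℤ using (ℤ; +_)
  import Data.Integer.Properties as ℤP
  open import Data.Integer.Tactic.RingSolver using (solve-∀)
  open import Data.Rational as ℚ using (ℚ; 0ℚ)
  import Data.Rational.Properties as ℚP
  open import Data.Product using (_,_)
  open import Relation.Binary.PropositionalEquality

  Ushape : ℤ → ℤ → ℚ → ℚ → ℚ → ℚ → ℚ → ℚ
  Ushape N M t₁ t₂ t₃ t₄ t₅ =
    fr (N ℤ.- M ℤ.+ + 2) (N ℤ.+ M) ℚ.* t₁
    ℚ.+ fr (N ℤ.- M ℤ.- + 2) (N ℤ.- M) ℚ.* t₂
    ℚ.+ fr (+ 2) (N ℤ.- M) ℚ.* t₃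
    ℚ.+ fr (+ 2) (N ℤ.+ M) ℚ.* t₄
    ℚ.+ fr (+ 4) ((N ℤ.+ M) ℤ.* (N ℤ.+ M ℤ.- + 2)) ℚ.* t₅

  Lshape : ℤ → ℤ → ℚ → ℚ → ℚ → ℚ → ℚ
  Lshape N M t₁ t₂ t₃ t₄ =
    fr (N ℤ.- M ℤ.+ + 2) (N ℤ.+ M) ℚ.* t₁
    ℚ.+ fr (N ℤ.- M ℤ.- + 2) (N ℤ.- M) ℚ.* t₂
    ℚ.+ fr (N ℤ.- M ℤ.- + 4) (N ℤ.- M ℤ.- + 2)
        ℚ.* (fr (+ 2) (N ℤ.- M) ℚ.* t₃
             ℚ.+ fr (+ 2) (N ℤ.+ M) ℚ.* t₄)

  N⟨_,_⟩ : ℕ → ℕ → ℤ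
  N⟨ α , β ⟩ = + (2 ℕ.+ α) ℤ.+ + suc β

  M⟨_,_⟩ : ℕ → ℕ → ℤ
  M⟨ α , β ⟩ = + (2 ℕ.+ α) ℤ.- + suc β

  F₀ F₁ F₂ : ℕ → ℤ
  F₀ α = + (α !)
  F₁ α = + suc α ℤ.* F₀ α
  F₂ α = + (2 ℕ.+ α) ℤ.* F₁ α

  Q : ℕ → ℕ → ℤ
  Q α β = F₂ α ℤ.* + suc β

  F₂-fact : ∀ α → + ((2 ℕ.+ α) !) ≡ F₂ α
  F₂-fact α = trans (fact-suc (suc α)) (cong (λ u → + (2 ℕ.+ α) ℤ.* u) (fact-suc α))

  F₁>0 : ∀ α → IsPos (F₁ α)
  F₁>0 α = pos-* (α , refl) (fact-pos α)

  F₂>0 : ∀ α → IsPos (F₂ α)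
  F₂>0 α = pos-* (suc α , refl) (F₁>0 α)

  Q>0 : ∀ α β → IsPos (Q α β)
  Q>0 α β = pos-* (F₂>0 α) (β , refl)

  private
    sum>0 : ∀ α β → IsPos (N⟨ α , β ⟩ ℤ.+ M⟨ α , β ⟩)
    sum>0 α β = 3 ℕ.+ α ℕ.+ α , identity (+ α) (+ β)
      where
      identity : ∀ a b → (+ 2 ℤ.+ a ℤ.+ (+ 1 ℤ.+ b)) ℤ.+ (+ 2 ℤ.+ a ℤ.- (+ 1 ℤ.+ b)) ≡ + 4 ℤ.+ a ℤ.+ a
      identity = solve-∀

    difference>0 : ∀ α β → IsPos (N⟨ α , β ⟩ ℤ.- M⟨ α , β ⟩)
    difference>0 α β = 1 ℕ.+ β ℕ.+ β , identity (+ α) (+ β)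
      where
      identity : ∀ a b → (+ 2 ℤ.+ a ℤ.+ (+ 1 ℤ.+ b)) ℤ.- (+ 2 ℤ.+ a ℤ.- (+ 1 ℤ.+ b)) ≡ + 2 ℤ.+ b ℤ.+ b
      identity = solve-∀

    sum-2>0 : ∀ α β → IsPos (N⟨ α , β ⟩ ℤ.+ M⟨ α , β ⟩ ℤ.- + 2)
    sum-2>0 α β = 1 ℕ.+ α ℕ.+ α , identity (+ α) (+ β)
      where
      identity : ∀ a b → (+ 2 ℤ.+ a ℤ.+ (+ 1 ℤ.+ b)) ℤ.+ (+ 2 ℤ.+ a ℤ.- (+ 1 ℤ.+ b)) ℤ.- + 2 ≡ + 2 ℤ.+ a ℤ.+ a
      identity = solve-∀

  Uhead-num : ℕ → ℤ → ℤ → ℤ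
  Uhead-num β x₁ x₂ = + (2 ℕ.+ β) ℤ.* + suc β ℤ.* x₁ ℤ.+ + β ℤ.* x₂

  Umid-num : ℕ → ℤ → ℤ → ℤ
  Umid-num β x₃ x₄ = x₃ ℤ.+ + suc β ℤ.* x₄

  module Terms (α β : ℕ) where
    private
      N = N⟨ α , β ⟩
      M = M⟨ α , β ⟩

    term₁ : ∀ x → fr (N ℤ.- M ℤ.+ + 2) (N ℤ.+ M) ℚ.* fr x (F₁ α) ≡ fr (+ (2 ℕ.+ β) ℤ.* + suc β ℤ.* x) (Q α β)
    term₁ x = fr-*-over _ _ x _ _ _ (sum>0 α β) (F₁>0 α) (Q>0 α β) (identity (+ α) (+ β) (F₀ α) x)
      where
      identity : ∀ a b F x →
        (+ 2 ℤ.+ a ℤ.+ (+ 1 ℤ.+ b) ℤ.- (+ 2 ℤ.+ a ℤ.- (+ 1 ℤ.+ b)) ℤ.+ + 2) ℤ.* x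
          ℤ.* ((+ 2 ℤ.+ a) ℤ.* ((+ 1 ℤ.+ a) ℤ.* F) ℤ.* (+ 1 ℤ.+ b))
        ≡ (+ 2 ℤ.+ b) ℤ.* (+ 1 ℤ.+ b) ℤ.* x
          ℤ.* ((+ 2 ℤ.+ a ℤ.+ (+ 1 ℤ.+ b) ℤ.+ (+ 2 ℤ.+ a ℤ.- (+ 1 ℤ.+ b))) ℤ.* ((+ 1 ℤ.+ a) ℤ.* F))
      identity = solve-∀

    term₂ : ∀ x → fr (N ℤ.- M ℤ.- + 2) (N ℤ.- M) ℚ.* fr x (F₂ α) ≡ fr (+ β ℤ.* x) (Q α β)
    term₂ x = fr-*-over _ _ x _ _ _ (difference>0 α β) (F₂>0 α) (Q>0 α β) (identity (+ α) (+ β) (F₀ α) x)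
      where
      identity : ∀ a b F x →
        (+ 2 ℤ.+ a ℤ.+ (+ 1 ℤ.+ b) ℤ.- (+ 2 ℤ.+ a ℤ.- (+ 1 ℤ.+ b)) ℤ.- + 2) ℤ.* x
          ℤ.* ((+ 2 ℤ.+ a) ℤ.* ((+ 1 ℤ.+ a) ℤ.* F) ℤ.* (+ 1 ℤ.+ b))
        ≡ b ℤ.* x
          ℤ.* ((+ 2 ℤ.+ a ℤ.+ (+ 1 ℤ.+ b) ℤ.- (+ 2 ℤ.+ a ℤ.- (+ 1 ℤ.+ b))) ℤ.* ((+ 2 ℤ.+ a) ℤ.* ((+ 1 ℤ.+ a) ℤ.* F)))
      identity = solve-∀

    term₃ : ∀ x → fr (+ 2) (N ℤ.- M) ℚ.* fr x (F₂ α) ≡ fr x (Q α β)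
    term₃ x = fr-*-over _ _ x _ _ _ (difference>0 α β) (F₂>0 α) (Q>0 α β) (identity (+ α) (+ β) (F₀ α) x)
      where
      identity : ∀ a b F x →
        + 2 ℤ.* x ℤ.* ((+ 2 ℤ.+ a) ℤ.* ((+ 1 ℤ.+ a) ℤ.* F) ℤ.* (+ 1 ℤ.+ b))
        ≡ x ℤ.* ((+ 2 ℤ.+ a ℤ.+ (+ 1 ℤ.+ b) ℤ.- (+ 2 ℤ.+ a ℤ.- (+ 1 ℤ.+ b))) ℤ.* ((+ 2 ℤ.+ a) ℤ.* ((+ 1 ℤ.+ a) ℤ.* F)))
      identity = solve-∀

    term₄ : ∀ x → fr (+ 2) (N ℤ.+ M) ℚ.* fr x (F₁ α) ≡ fr (+ suc β ℤ.* x) (Q α β)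
    term₄ x = fr-*-over _ _ x _ _ _ (sum>0 α β) (F₁>0 α) (Q>0 α β) (identity (+ α) (+ β) (F₀ α) x)
      where
      identity : ∀ a b F x →
        + 2 ℤ.* x ℤ.* ((+ 2 ℤ.+ a) ℤ.* ((+ 1 ℤ.+ a) ℤ.* F) ℤ.* (+ 1 ℤ.+ b))
        ≡ (+ 1 ℤ.+ b) ℤ.* x ℤ.* ((+ 2 ℤ.+ a ℤ.+ (+ 1 ℤ.+ b) ℤ.+ (+ 2 ℤ.+ a ℤ.- (+ 1 ℤ.+ b))) ℤ.* ((+ 1 ℤ.+ a) ℤ.* F))
      identity = solve-∀

    term₅ : ∀ x → fr (+ 4) ((N ℤ.+ M) ℤ.* (N ℤ.+ M ℤ.- + 2)) ℚ.* fr x (F₀ α) ≡ fr (+ suc β ℤ.* x) (Q α β)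
    term₅ x = fr-*-over _ _ x _ _ _ (pos-* (sum>0 α β) (sum-2>0 α β)) (fact-pos α) (Q>0 α β)
                        (identity (+ α) (+ β) (F₀ α) x)
      where
      identity : ∀ a b F x →
        + 4 ℤ.* x ℤ.* ((+ 2 ℤ.+ a) ℤ.* ((+ 1 ℤ.+ a) ℤ.* F) ℤ.* (+ 1 ℤ.+ b))
        ≡ (+ 1 ℤ.+ b) ℤ.* x
          ℤ.* (((+ 2 ℤ.+ a ℤ.+ (+ 1 ℤ.+ b) ℤ.+ (+ 2 ℤ.+ a ℤ.- (+ 1 ℤ.+ b)))
                ℤ.* (+ 2 ℤ.+ a ℤ.+ (+ 1 ℤ.+ b) ℤ.+ (+ 2 ℤ.+ a ℤ.- (+ 1 ℤ.+ b)) ℤ.- + 2)) ℤ.* F)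
      identity = solve-∀

    head : ∀ x₁ x₂ → fr (N ℤ.- M ℤ.+ + 2) (N ℤ.+ M) ℚ.* fr x₁ (F₁ α) ℚ.+ fr (N ℤ.- M ℤ.- + 2) (N ℤ.- M) ℚ.* fr x₂ (F₂ α)
                     ≡ fr (Uhead-num β x₁ x₂) (Q α β)
    head x₁ x₂ = trans (cong₂ ℚ._+_ (term₁ x₁) (term₂ x₂)) (fr-+ (Q>0 α β))

    middle : ∀ x₃ x₄ → fr (+ 2) (N ℤ.- M) ℚ.* fr x₃ (F₂ α) ℚ.+ fr (+ 2) (N ℤ.+ M) ℚ.* fr x₄ (F₁ α)
                       ≡ fr (Umid-num β x₃ x₄) (Q α β)
    middle x₃ x₄ = trans (cong₂ ℚ._+_ (term₃ x₃) (term₄ x₄)) (fr-+ (Q>0 α β))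

  Unum-num : ℕ → ℤ → ℤ → ℤ → ℤ → ℤ → ℤ
  Unum-num β x₁ x₂ x₃ x₄ x₅ = Uhead-num β x₁ x₂ ℤ.+ Umid-num β x₃ x₄ ℤ.+ + suc β ℤ.* x₅

  U-fraction : ∀ α β x₁ x₂ x₃ x₄ x₅ →
    Ushape N⟨ α , β ⟩ M⟨ α , β ⟩ (fr x₁ (F₁ α)) (fr x₂ (F₂ α)) (fr x₃ (F₂ α)) (fr x₄ (F₁ α)) (fr x₅ (F₀ α))
      ≡ fr (Unum-num β x₁ x₂ x₃ x₄ x₅) (Q α β)
  U-fraction α β x₁ x₂ x₃ x₄ x₅ = begin
    Ushape N⟨ α , β ⟩ M⟨ α , β ⟩ (fr x₁ (F₁ α)) (fr x₂ (F₂ α)) (fr x₃ (F₂ α)) (fr x₄ (F₁ α)) (fr x₅ (F₀ α))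
      ≡⟨ cong₂ ℚ._+_ (cong₂ ℚ._+_ (cong₂ ℚ._+_ (head x₁ x₂) (term₃ x₃)) (term₄ x₄)) (term₅ x₅) ⟩
    fr h q ℚ.+ fr x₃ q ℚ.+ fr (+ suc β ℤ.* x₄) q ℚ.+ fr (+ suc β ℤ.* x₅) q
      ≡⟨ cong (λ u → u ℚ.+ fr (+ suc β ℤ.* x₄) q ℚ.+ fr (+ suc β ℤ.* x₅) q) (fr-+ q>0) ⟩
    fr (h ℤ.+ x₃) q ℚ.+ fr (+ suc β ℤ.* x₄) q ℚ.+ fr (+ suc β ℤ.* x₅) q
      ≡⟨ cong (λ u → u ℚ.+ fr (+ suc β ℤ.* x₅) q) (fr-+ q>0) ⟩
    fr (h ℤ.+ x₃ ℤ.+ + suc β ℤ.* x₄) q ℚ.+ fr (+ suc β ℤ.* x₅) q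
      ≡⟨ fr-+ q>0 ⟩
    fr (h ℤ.+ x₃ ℤ.+ + suc β ℤ.* x₄ ℤ.+ + suc β ℤ.* x₅) q
      ≡⟨ cong (λ u → fr (u ℤ.+ + suc β ℤ.* x₅) q) (ℤP.+-assoc h x₃ (+ suc β ℤ.* x₄)) ⟩
    fr (Unum-num β x₁ x₂ x₃ x₄ x₅) q ∎
    where
    open ≡-Reasoning
    open Terms α β
    h = Uhead-num β x₁ x₂
    q = Q α β
    q>0 = Q>0 α β

  -- L_e at the point for β = 0: the middle part carries the factor 0/0 = 0.
  L-fraction₀ : ∀ α x₁ x₂ x₃ x₄ →
    Lshape N⟨ α , 0 ⟩ M⟨ α , 0 ⟩ (fr x₁ (F₁ α)) (fr x₂ (F₂ α)) (fr x₃ (F₂ α)) (fr x₄ (F₁ α))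
      ≡ fr (Uhead-num 0 x₁ x₂) (Q α 0)
  L-fraction₀ α x₁ x₂ x₃ x₄ = begin
    Lshape N M (fr x₁ (F₁ α)) (fr x₂ (F₂ α)) (fr x₃ (F₂ α)) (fr x₄ (F₁ α))
      ≡⟨ cong₂ ℚ._+_ (head x₁ x₂) (cong (ℚ._* mid) (cong (fr (N ℤ.- M ℤ.- + 4)) (n-m-2≡0 (+ α)))) ⟩
    fr (Uhead-num 0 x₁ x₂) (Q α 0) ℚ.+ 0ℚ ℚ.* mid
      ≡⟨ cong (fr (Uhead-num 0 x₁ x₂) (Q α 0) ℚ.+_) (ℚP.*-zeroˡ mid) ⟩
    fr (Uhead-num 0 x₁ x₂) (Q α 0) ℚ.+ 0ℚ
      ≡⟨ ℚP.+-identityʳ _ ⟩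
    fr (Uhead-num 0 x₁ x₂) (Q α 0) ∎
    where
    open ≡-Reasoning
    open Terms α 0
    N = N⟨ α , 0 ⟩
    M = M⟨ α , 0 ⟩
    mid = fr (+ 2) (N ℤ.- M) ℚ.* fr x₃ (F₂ α) ℚ.+ fr (+ 2) (N ℤ.+ M) ℚ.* fr x₄ (F₁ α)
    n-m-2≡0 : ∀ a → (+ 2 ℤ.+ a ℤ.+ + 1) ℤ.- (+ 2 ℤ.+ a ℤ.- + 1) ℤ.- + 2 ≡ + 0
    n-m-2≡0 = solve-∀

  L-fraction : ∀ α γ x₁ x₂ x₃ x₄ →
    Lshape N⟨ α , suc γ ⟩ M⟨ α , suc γ ⟩ (fr x₁ (F₁ α)) (fr x₂ (F₂ α)) (fr x₃ (F₂ α)) (fr x₄ (F₁ α))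
      ≡ fr (+ suc γ ℤ.* Uhead-num (suc γ) x₁ x₂ ℤ.+ + γ ℤ.* Umid-num (suc γ) x₃ x₄) (Q α (suc γ) ℤ.* + suc γ)
  L-fraction α γ x₁ x₂ x₃ x₄ = begin
    Lshape N M (fr x₁ (F₁ α)) (fr x₂ (F₂ α)) (fr x₃ (F₂ α)) (fr x₄ (F₁ α))
      ≡⟨ cong₂ ℚ._+_ (head x₁ x₂) (cong (fr (N ℤ.- M ℤ.- + 4) (N ℤ.- M ℤ.- + 2) ℚ.*_) (middle x₃ x₄)) ⟩
    fr h q ℚ.+ fr (N ℤ.- M ℤ.- + 4) (N ℤ.- M ℤ.- + 2) ℚ.* fr mid q
      ≡⟨ cong₂ ℚ._+_ (fr-cross q>0 qβ>0 (rescale h (Q α (suc γ)) (+ suc γ)))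
                     (fr-*-over _ _ mid _ _ _ n-m-2>0 q>0 qβ>0 (identity (+ α) (+ γ) mid (Q α (suc γ)))) ⟩
    fr (+ suc γ ℤ.* h) qβ ℚ.+ fr (+ γ ℤ.* mid) qβ
      ≡⟨ fr-+ qβ>0 ⟩
    fr (+ suc γ ℤ.* h ℤ.+ + γ ℤ.* mid) qβ ∎
    where
    open ≡-Reasoning
    open Terms α (suc γ)
    N = N⟨ α , suc γ ⟩
    M = M⟨ α , suc γ ⟩
    h = Uhead-num (suc γ) x₁ x₂
    mid = Umid-num (suc γ) x₃ x₄
    q = Q α (suc γ)
    q>0 = Q>0 α (suc γ)
    qβ = Q α (suc γ) ℤ.* + suc γ
    qβ>0 = pos-* q>0 (γ , refl)
    n-m-2>0 : IsPos (N ℤ.- M ℤ.- + 2)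
    n-m-2>0 = suc (γ ℕ.+ γ) , n-m-2≡ (+ α) (+ γ)
      where
      n-m-2≡ : ∀ a g → (+ 2 ℤ.+ a ℤ.+ (+ 1 ℤ.+ (+ 1 ℤ.+ g))) ℤ.- (+ 2 ℤ.+ a ℤ.- (+ 1 ℤ.+ (+ 1 ℤ.+ g))) ℤ.- + 2
                   ≡ + 2 ℤ.+ g ℤ.+ g
      n-m-2≡ = solve-∀
    rescale : ∀ h Q B → h ℤ.* (Q ℤ.* B) ≡ B ℤ.* h ℤ.* Q
    rescale = solve-∀
    identity : ∀ a g x Q →
      ((+ 2 ℤ.+ a ℤ.+ (+ 1 ℤ.+ (+ 1 ℤ.+ g))) ℤ.- (+ 2 ℤ.+ a ℤ.- (+ 1 ℤ.+ (+ 1 ℤ.+ g))) ℤ.- + 4) ℤ.* x ℤ.* (Q ℤ.* (+ 1 ℤ.+ g))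
        ≡ g ℤ.* x ℤ.* (((+ 2 ℤ.+ a ℤ.+ (+ 1 ℤ.+ (+ 1 ℤ.+ g))) ℤ.- (+ 2 ℤ.+ a ℤ.- (+ 1 ℤ.+ (+ 1 ℤ.+ g))) ℤ.- + 2) ℤ.* Q)
    identity = solve-∀

  Ushape-zero : ∀ N M → Ushape N M 0ℚ 0ℚ 0ℚ 0ℚ 0ℚ ≡ 0ℚ
  Ushape-zero N M
    rewrite ℚP.*-zeroʳ (fr (N ℤ.- M ℤ.+ + 2) (N ℤ.+ M)) | ℚP.*-zeroʳ (fr (N ℤ.- M ℤ.- + 2) (N ℤ.- M))
          | ℚP.*-zeroʳ (fr (+ 2) (N ℤ.- M)) | ℚP.*-zeroʳ (fr (+ 2) (N ℤ.+ M))
          | ℚP.*-zeroʳ (fr (+ 4) ((N ℤ.+ M) ℤ.* (N ℤ.+ M ℤ.- + 2))) = refl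

  Lshape-zero : ∀ N M → Lshape N M 0ℚ 0ℚ 0ℚ 0ℚ ≡ 0ℚ
  Lshape-zero N M
    rewrite ℚP.*-zeroʳ (fr (N ℤ.- M ℤ.+ + 2) (N ℤ.+ M)) | ℚP.*-zeroʳ (fr (N ℤ.- M ℤ.- + 2) (N ℤ.- M))
          | ℚP.*-zeroʳ (fr (+ 2) (N ℤ.- M)) | ℚP.*-zeroʳ (fr (+ 2) (N ℤ.+ M))
          | ℚP.*-zeroʳ (fr (N ℤ.- M ℤ.- + 4) (N ℤ.- M ℤ.- + 2)) = refl

module Numerators where

  open Certificates
  open CArray
  open Values using (prevcol)
  open BoundFractions using (Uhead-num; Umid-num; Unum-num)
  open import Data.Nat as ℕ using (ℕ; zero; suc; z≤n; s≤s)
  import Data.Nat.Properties as ℕP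
  open import Data.Integer using (ℤ; +_; _+_; _-_; _*_; _≤_)
  import Data.Integer.Properties as ℤP
  open import Data.Integer.Tactic.RingSolver using (solve-∀; solve)
  open import Data.List using (_∷_; [])
  open import Relation.Binary.PropositionalEquality

  -- Fix the point (n,m) with (n+m)/2 = α+2 and (n-m)/2 = β+1.  Over the common
  -- denominator (α+2)!(β+1) the value of an array f at (n,m) has numerator
  -- `top f α β`, and the upper bound U has numerator `Unum f α β`, split as
  -- head (the terms at (n-1,m∓1)), middle (at (n-2,m+2), (n-3,m+1)) and
  -- the last term (at (n-3,m-1)).
  top : (ℕ → ℕ → ℤ) → ℕ → ℕ → ℤ
  top f α β = f (2 ℕ.+ α) (suc β) * + suc β

  Uhead : (ℕ → ℕ → ℤ) → ℕ → ℕ → ℤ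
  Uhead f α β = Uhead-num β (f (suc α) (suc β)) (f (2 ℕ.+ α) β)

  Umid : (ℕ → ℕ → ℤ) → ℕ → ℕ → ℤ
  Umid f α β = Umid-num β (prevcol f (2 ℕ.+ α) β) (prevcol f (suc α) β)

  Unum : (ℕ → ℕ → ℤ) → ℕ → ℕ → ℤ
  Unum f α β = Unum-num β (f (suc α) (suc β)) (f (2 ℕ.+ α) β) (prevcol f (2 ℕ.+ α) β) (prevcol f (suc α) β) (f α β)

  -- e ≤ U_e: the subtracted terms of the recurrence only help.
  top≤Unum : ∀ α β → β ℕ.≤ suc α → top c α β ≤ Unum c α β
  top≤Unum α zero _ =
    ≤-by (+ 0) (nonneg-nat 0)
      (identity (c (suc α) 1) (c (2 ℕ.+ α) 0) (c α 0) (c-first-column (2 ℕ.+ α)) (c-first-column α)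
                (c-rec (suc α) 0 z≤n))
    where
    identity : ∀ x₁ x₂ x₅ {x₀} → x₂ ≡ + 1 → x₅ ≡ + 1 → x₀ ≡ x₂ + + 2 * x₁ - + 0 * x₅ →
      (+ 2 * + 1 * x₁ + + 0 * x₂ + (+ 0 + + 1 * + 0) + + 1 * x₅) - x₀ * + 1 ≡ + 0
    identity x₁ _ _ refl refl refl = solve (x₁ ∷ [])
  top≤Unum α (suc γ) (s≤s γ≤α) =
    ≤-by ((+ 2 + + γ) * + γ * W + + γ * Y)
      (nonneg-+ (nonneg-* (nonneg-* (nonneg-nat (2 ℕ.+ γ)) (nonneg-nat γ)) (nonneg-≥0 (c-prev-nonneg α γ)))
                (nonneg-* (nonneg-nat γ) (nonneg-≥0 (c-nonneg α γ))))
      (identity (+ γ) (c (suc α) (suc (suc γ))) (c (2 ℕ.+ α) γ) (c (suc α) γ) (c α (suc γ)) Y W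
        (c-rec α γ γ≤α) (c-rec (suc α) γ (ℕP.m≤n⇒m≤1+n γ≤α)) (c-rec (suc α) (suc γ) (s≤s γ≤α)))
    where
    Y = c α γ
    W = c-prev α γ
    identity : ∀ g x₁ x₃ x₄ x₅ Y W {x₀ x₂ P} →
      P ≡ x₄ + (+ 2 + g) * x₅ - g * W →
      x₂ ≡ x₃ + (+ 2 + g) * P - g * Y →
      x₀ ≡ x₂ + (+ 3 + g) * x₁ - (+ 1 + g) * x₅ →
      ((+ 3 + g) * (+ 2 + g) * x₁ + (+ 1 + g) * x₂ + (x₃ + (+ 2 + g) * x₄) + (+ 2 + g) * x₅) - x₀ * (+ 2 + g)
        ≡ (+ 2 + g) * g * W + g * Y
    identity g x₁ x₃ x₄ x₅ Y W refl refl refl = solve (g ∷ x₁ ∷ x₃ ∷ x₄ ∷ x₅ ∷ Y ∷ W ∷ [])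

  -- U_e ≤ U_d: the numerator is monotone in the array, all coefficients being nonnegative.
  prevcol-mono : ∀ {f g} → (∀ a b → f a b ≤ g a b) → ∀ a b → prevcol f a b ≤ prevcol g a b
  prevcol-mono f≤g a zero = ℤP.≤-refl
  prevcol-mono f≤g a (suc b) = f≤g a b

  Unum-mono : ∀ {f g} → (∀ a b → f a b ≤ g a b) → ∀ α β → Unum f α β ≤ Unum g α β
  Unum-mono {f} {g} f≤g α β =
    ≤-by (+ (2 ℕ.+ β) * + suc β * δ (suc α) (suc β) + + β * δ (2 ℕ.+ α) β
          + (δ′ (2 ℕ.+ α) β + + suc β * δ′ (suc α) β) + + suc β * δ α β)
      (nonneg-+ (nonneg-+ (nonneg-+ (nonneg-* (nonneg-* (nonneg-nat (2 ℕ.+ β)) (nonneg-nat (suc β))) (δ≥0 (suc α) (suc β)))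
                                    (nonneg-* (nonneg-nat β) (δ≥0 (2 ℕ.+ α) β)))
                          (nonneg-+ (δ′≥0 (2 ℕ.+ α) β) (nonneg-* (nonneg-nat (suc β)) (δ′≥0 (suc α) β))))
                (nonneg-* (nonneg-nat (suc β)) (δ≥0 α β)))
      (identity (+ (2 ℕ.+ β)) (+ suc β) (+ β)
                (f (suc α) (suc β)) (f (2 ℕ.+ α) β) (prevcol f (2 ℕ.+ α) β) (prevcol f (suc α) β) (f α β)
                (g (suc α) (suc β)) (g (2 ℕ.+ α) β) (prevcol g (2 ℕ.+ α) β) (prevcol g (suc α) β) (g α β))
    where
    δ δ′ : ℕ → ℕ → ℤ
    δ a b = g a b - f a b
    δ′ a b = prevcol g a b - prevcol f a b
    δ≥0 : ∀ a b → Nonneg (δ a b)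
    δ≥0 a b = nonneg-gap (f≤g a b)
    δ′≥0 : ∀ a b → Nonneg (δ′ a b)
    δ′≥0 a b = nonneg-gap (prevcol-mono f≤g a b)
    identity : ∀ A B b x₁ x₂ x₃ x₄ x₅ y₁ y₂ y₃ y₄ y₅ →
      (A * B * y₁ + b * y₂ + (y₃ + B * y₄) + B * y₅) - (A * B * x₁ + b * x₂ + (x₃ + B * x₄) + B * x₅)
        ≡ A * B * (y₁ - x₁) + b * (y₂ - x₂) + ((y₃ - x₃) + B * (y₄ - x₄)) + B * (y₅ - x₅)
    identity = solve-∀

  -- U_d ≤ d: for c⁺ the recurrence is exact and U_d misses only a nonnegative term.
  Unum≤top⁺ : ∀ α β → β ℕ.≤ suc α → Unum c⁺ℤ α β ≤ top c⁺ℤ α β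
  Unum≤top⁺ α zero _ =
    ≤-by (+ 0) (nonneg-nat 0) (identity (c⁺ℤ (suc α) 1) (c⁺ℤ-rec (suc α) 0 z≤n))
    where
    identity : ∀ x₁ {x₀} → x₀ ≡ + 1 + + 2 * x₁ →
      x₀ * + 1 - (+ 2 * + 1 * x₁ + + 0 * + 1 + (+ 0 + + 1 * + 0) + + 1 * + 1) ≡ + 0
    identity x₁ refl = solve (x₁ ∷ [])
  Unum≤top⁺ α (suc γ) (s≤s γ≤α) =
    ≤-by ((+ 2 + + γ) * (+ 1 + + γ) * c⁺ℤ α (suc γ))
      (nonneg-* (nonneg-* (nonneg-nat (2 ℕ.+ γ)) (nonneg-nat (suc γ))) (nonneg-nat (c⁺ (α) (suc γ))))
      (identity (+ γ) (c⁺ℤ (suc α) (suc (suc γ))) (c⁺ℤ (2 ℕ.+ α) γ) (c⁺ℤ (suc α) γ) (c⁺ℤ α (suc γ))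
        (c⁺ℤ-rec α γ γ≤α) (c⁺ℤ-rec (suc α) γ (ℕP.m≤n⇒m≤1+n γ≤α)) (c⁺ℤ-rec (suc α) (suc γ) (s≤s γ≤α)))
    where
    identity : ∀ g x₁ x₃ x₄ x₅ {x₀ x₂ P} →
      P ≡ x₄ + (+ 2 + g) * x₅ →
      x₂ ≡ x₃ + (+ 2 + g) * P →
      x₀ ≡ x₂ + (+ 3 + g) * x₁ →
      x₀ * (+ 2 + g) - ((+ 3 + g) * (+ 2 + g) * x₁ + (+ 1 + g) * x₂ + (x₃ + (+ 2 + g) * x₄) + (+ 2 + g) * x₅)
        ≡ (+ 2 + g) * (+ 1 + g) * x₅
    identity g x₁ x₃ x₄ x₅ refl refl refl = solve (g ∷ x₁ ∷ x₃ ∷ x₄ ∷ x₅ ∷ [])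

  -- For β = 0 the lower bound consists of the head alone; otherwise
  -- it is head + (β-1)/β · middle, and the gap is controlled by column growth
  -- b c_{a,b} ≤ c_{a+1,b} and weak row growth b c_{a-1,b} ≤ c_{a,b+1}.
  Uhead≤top : ∀ α → Uhead c α 0 ≤ top c α 0
  Uhead≤top α =
    ≤-by (+ 1) (nonneg-nat 1)
      (identity (c (suc α) 1) (c (2 ℕ.+ α) 0) (c α 0) (c-first-column (2 ℕ.+ α)) (c-first-column α)
                (c-rec (suc α) 0 z≤n))
    where
    identity : ∀ x₁ x₂ x₅ {x₀} → x₂ ≡ + 1 → x₅ ≡ + 1 → x₀ ≡ x₂ + + 2 * x₁ - + 0 * x₅ →
      x₀ * + 1 - (+ 2 * + 1 * x₁ + + 0 * x₂) ≡ + 1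
    identity x₁ _ _ refl refl refl = solve (x₁ ∷ [])

  lower≤top : ∀ α γ → γ ℕ.≤ α →
    + suc γ * Uhead c α (suc γ) + + γ * Umid c α (suc γ) ≤ top c α (suc γ) * + suc γ
  lower≤top α γ γ≤α =
    ≤-by (x₃ + (+ 2 + + γ) * (x₄ - + γ * Y) + (+ 2 + + γ) * (+ 1 + + γ) * (x₅ - + γ * W) + + γ * Y)
      (nonneg-+ (nonneg-+ (nonneg-+ (nonneg-≥0 (c-nonneg (2 ℕ.+ α) γ))
                                    (nonneg-* (nonneg-nat (2 ℕ.+ γ)) (nonneg-gap (c-column α γ))))
                          (nonneg-* (nonneg-* (nonneg-nat (2 ℕ.+ γ)) (nonneg-nat (suc γ)))
                                    (nonneg-gap (c-weak-growth-prev α γ))))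
                (nonneg-* (nonneg-nat γ) (nonneg-≥0 (c-nonneg α γ))))
      (identity (+ γ) (c (suc α) (suc (suc γ))) x₃ x₄ x₅ Y W
        (c-rec α γ γ≤α) (c-rec (suc α) γ (ℕP.m≤n⇒m≤1+n γ≤α)) (c-rec (suc α) (suc γ) (s≤s γ≤α)))
    where
    x₃ = c (2 ℕ.+ α) γ
    x₄ = c (suc α) γ
    x₅ = c α (suc γ)
    Y = c α γ
    W = c-prev α γ
    identity : ∀ g x₁ x₃ x₄ x₅ Y W {x₀ x₂ P} →
      P ≡ x₄ + (+ 2 + g) * x₅ - g * W →
      x₂ ≡ x₃ + (+ 2 + g) * P - g * Y →
      x₀ ≡ x₂ + (+ 3 + g) * x₁ - (+ 1 + g) * x₅ →
      x₀ * (+ 2 + g) * (+ 1 + g) - ((+ 1 + g) * ((+ 3 + g) * (+ 2 + g) * x₁ + (+ 1 + g) * x₂) + g * (x₃ + (+ 2 + g) * x₄))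
        ≡ x₃ + (+ 2 + g) * (x₄ - g * Y) + (+ 2 + g) * (+ 1 + g) * (x₅ - g * W) + g * Y
    identity g x₁ x₃ x₄ x₅ Y W refl refl refl = solve (g ∷ x₁ ∷ x₃ ∷ x₄ ∷ x₅ ∷ Y ∷ W ∷ [])

module Cases where

  open Fractions
  open CArray using (c-above; c⁺ℤ; c⁺ℤ-above; c≤c⁺)
  open Values
  open DValues using (d-value; dM-value)
  open BoundFractions
  open Numerators
  open import Data.Nat as ℕ using (ℕ; zero; suc; _%_)
  import Data.Nat.Properties as ℕP
  import Data.Nat.Tactic.RingSolver as ℕSolver
  open import Data.Integer as ℤ using (ℤ; +_)
  import Data.Integer.Tactic.RingSolver as ℤSolver
  open import Data.Rational as ℚ using (ℚ; 0ℚ)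
  import Data.Rational.Properties as ℚP
  open import Data.Product using (_×_; _,_)
  open import Data.Empty using (⊥-elim)
  open import Relation.Binary.PropositionalEquality

  Goal : ℕ → ℕ → Set
  Goal n m = (Le n m ℚ.≤ e n m × e n m ℚ.≤ Ue n m) × (Ue n m ℚ.≤ Ud n m × Ud n m ℚ.≤ d n m)

  Ushape-cong : ∀ {N N′ M M′ t₁ t₁′ t₂ t₂′ t₃ t₃′ t₄ t₄′ t₅ t₅′} → N ≡ N′ → M ≡ M′ →
    t₁ ≡ t₁′ → t₂ ≡ t₂′ → t₃ ≡ t₃′ → t₄ ≡ t₄′ → t₅ ≡ t₅′ →
    Ushape N M t₁ t₂ t₃ t₄ t₅ ≡ Ushape N′ M′ t₁′ t₂′ t₃′ t₄′ t₅′
  Ushape-cong refl refl refl refl refl refl refl = refl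

  Lshape-cong : ∀ {N N′ M M′ t₁ t₁′ t₂ t₂′ t₃ t₃′ t₄ t₄′} → N ≡ N′ → M ≡ M′ →
    t₁ ≡ t₁′ → t₂ ≡ t₂′ → t₃ ≡ t₃′ → t₄ ≡ t₄′ →
    Lshape N M t₁ t₂ t₃ t₄ ≡ Lshape N′ M′ t₁′ t₂′ t₃′ t₄′
  Lshape-cong refl refl refl refl refl refl = refl

  eM-value : ∀ n m → eM n m ≡ value₋ c n m
  eM-value n zero = refl
  eM-value n (suc m) = refl

  U-values : ∀ {f fM} g → (∀ x y → f x y ≡ value g x y) → (∀ x y → fM x y ≡ value₋ g x y) →
    ∀ n m → U f fM n m ≡ U (value g) (value₋ g) n m
  U-values g f≡ fM≡ n m = Ushape-cong {+ n} {+ n} {+ m} {+ m} refl refl (fM≡ _ m) (f≡ _ _) (f≡ _ _) (f≡ _ _) (fM≡ _ m)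

  Ue-values : ∀ n m → Ue n m ≡ U (value c) (value₋ c) n m
  Ue-values = U-values c (λ _ _ → refl) eM-value

  Ud-values : ∀ n m → Ud n m ≡ U (value c⁺ℤ) (value₋ c⁺ℤ) n m
  Ud-values = U-values c⁺ℤ d-value dM-value

  Le-values : ∀ n m → Le n m ≡ Lshape (+ n) (+ m) (value₋ c (n ℕ.∸ 1) m) (value c (n ℕ.∸ 1) (suc m))
                                      (value c (n ℕ.∸ 2) (suc (suc m))) (value c (n ℕ.∸ 3) (suc m))
  Le-values n m = Lshape-cong {+ n} {+ n} {+ m} {+ m} refl refl (eM-value _ m) refl refl refl

  Goal-equal : ∀ n m q → Le n m ≡ q → e n m ≡ q → Ue n m ≡ q → Ud n m ≡ q → d n m ≡ q → Goal n m
  Goal-equal n m q Le≡ e≡ Ue≡ Ud≡ d≡ =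
    (ℚP.≤-reflexive (trans Le≡ (sym e≡)) , ℚP.≤-reflexive (trans e≡ (sym Ue≡))) ,
    (ℚP.≤-reflexive (trans Ue≡ (sym Ud≡)) , ℚP.≤-reflexive (trans Ud≡ (sym d≡)))

  -- If n - m is odd, every point entering the lemma has odd coordinate sum,
  -- so all quantities vanish.
  module OddCase (k m j : ℕ) (distance : suc (suc (suc k)) ≡ m ℕ.+ suc (j ℕ.+ j)) where
    n = suc (suc (suc k))

    private
      sum-odd : (n ℕ.+ m) % 2 ≡ 1
      sum-odd = odd-distance-parity j distance

      shift₀ : ∀ k m → suc (suc (suc k) ℕ.+ m ℕ.+ (0 ℕ.+ 0)) ≡ suc (suc (suc k)) ℕ.+ m
      shift₀ = ℕSolver.solve-∀
      shift₁ : ∀ k m → suc (suc k) ℕ.+ suc m ℕ.+ (0 ℕ.+ 0) ≡ suc (suc (suc k)) ℕ.+ m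
      shift₁ = ℕSolver.solve-∀
      shift₂ : ∀ k m → suc k ℕ.+ suc (suc m) ℕ.+ (0 ℕ.+ 0) ≡ suc (suc (suc k)) ℕ.+ m
      shift₂ = ℕSolver.solve-∀
      shift₃ : ∀ k m → k ℕ.+ suc m ℕ.+ (1 ℕ.+ 1) ≡ suc (suc (suc k)) ℕ.+ m
      shift₃ = ℕSolver.solve-∀
      shift₄ : ∀ k m → suc (k ℕ.+ m ℕ.+ (1 ℕ.+ 1)) ≡ suc (suc (suc k)) ℕ.+ m
      shift₄ = ℕSolver.solve-∀

    value-zero : ∀ f → value f n m ≡ 0ℚ
    value-zero f = value-odd f n m 0 (n ℕ.+ m) (ℕP.+-identityʳ (n ℕ.+ m)) sum-odd

    U-zero : ∀ f → U (value f) (value₋ f) n m ≡ 0ℚ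
    U-zero f = begin
      U (value f) (value₋ f) n m
        ≡⟨ Ushape-cong {+ n} {+ n} {+ m} {+ m} refl refl
             (value₋-odd f (suc (suc k)) m 0 (n ℕ.+ m) (shift₀ k m) sum-odd)
             (value-odd f (suc (suc k)) (suc m) 0 (n ℕ.+ m) (shift₁ k m) sum-odd)
             (value-odd f (suc k) (suc (suc m)) 0 (n ℕ.+ m) (shift₂ k m) sum-odd)
             (value-odd f k (suc m) 1 (n ℕ.+ m) (shift₃ k m) sum-odd)
             (value₋-odd f k m 1 (n ℕ.+ m) (shift₄ k m) sum-odd) ⟩
      Ushape (+ n) (+ m) 0ℚ 0ℚ 0ℚ 0ℚ 0ℚ
        ≡⟨ Ushape-zero (+ n) (+ m) ⟩
      0ℚ ∎
      where open ≡-Reasoning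

    L-zero : Le n m ≡ 0ℚ
    L-zero = begin
      Le n m
        ≡⟨ Le-values n m ⟩
      Lshape (+ n) (+ m) (value₋ c (suc (suc k)) m) (value c (suc (suc k)) (suc m))
                         (value c (suc k) (suc (suc m))) (value c k (suc m))
        ≡⟨ Lshape-cong {+ n} {+ n} {+ m} {+ m} refl refl
             (value₋-odd c (suc (suc k)) m 0 (n ℕ.+ m) (shift₀ k m) sum-odd)
             (value-odd c (suc (suc k)) (suc m) 0 (n ℕ.+ m) (shift₁ k m) sum-odd)
             (value-odd c (suc k) (suc (suc m)) 0 (n ℕ.+ m) (shift₂ k m) sum-odd)
             (value-odd c k (suc m) 1 (n ℕ.+ m) (shift₃ k m) sum-odd) ⟩
      Lshape (+ n) (+ m) 0ℚ 0ℚ 0ℚ 0ℚ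
        ≡⟨ Lshape-zero (+ n) (+ m) ⟩
      0ℚ ∎
      where open ≡-Reasoning

    goal : Goal n m
    goal = Goal-equal n m 0ℚ L-zero (value-zero c) (trans (Ue-values n m) (U-zero c))
                      (trans (Ud-values n m) (U-zero c⁺ℤ)) (trans (d-value n m) (value-zero c⁺ℤ))

  halve : ∀ k m β → suc (suc (suc k)) ≡ m ℕ.+ (suc β ℕ.+ suc β) → suc k ≡ m ℕ.+ (β ℕ.+ β)
  halve k m β distance = ℕP.suc-injective (ℕP.suc-injective (trans distance (shift m β)))
    where
    shift : ∀ m β → m ℕ.+ (suc β ℕ.+ suc β) ≡ suc (suc (m ℕ.+ (β ℕ.+ β)))
    shift = ℕSolver.solve-∀

  module EvenCase (k m β α : ℕ) (n-distance : suc (suc (suc k)) ≡ m ℕ.+ (suc β ℕ.+ suc β))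
                  (midpoint : m ℕ.+ β ≡ suc α) where
    n = suc (suc (suc k))

    β≤1+α : β ℕ.≤ suc α
    β≤1+α = subst (β ℕ.≤_) midpoint (ℕP.m≤n+m β m)

    private
      distance : suc k ≡ m ℕ.+ (β ℕ.+ β)
      distance = halve k m β n-distance

      midpoint′ : m ℕ.+ suc β ≡ suc (suc α)
      midpoint′ = trans (ℕP.+-suc m β) (cong suc midpoint)

      n≡N : + n ≡ N⟨ α , β ⟩
      n≡N = cong +_ (trans n-distance
                           (trans (sym (ℕP.+-assoc m (suc β) (suc β))) (cong (ℕ._+ suc β) midpoint′)))

      m≡M : + m ≡ M⟨ α , β ⟩
      m≡M = trans (identity (+ m) (+ suc β)) (cong (λ u → + u ℤ.- + suc β) midpoint′)
        where
        identity : ∀ m b → m ≡ m ℤ.+ b ℤ.- b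
        identity = ℤSolver.solve-∀

    module Points (f : ℕ → ℕ → ℤ) (f-vanishes : Vanishing f) where
      at-n,m : value f n m ≡ fr (f (2 ℕ.+ α) (suc β)) (F₂ α)
      at-n,m = trans (value-at-point f {n} {m} {2 ℕ.+ α} {suc β} n-distance midpoint′)
                     (cong (fr _) (F₂-fact α))

      at-n-1,m-1 : value₋ f (suc (suc k)) m ≡ fr (f (suc α) (suc β)) (F₁ α)
      at-n-1,m-1 = trans (value₋-at-point f f-vanishes {suc (suc k)} {m} {suc α} {suc β} n-distance midpoint′)
                         (cong (fr _) (fact-suc α))

      at-n-1,m+1 : value f (suc (suc k)) (suc m) ≡ fr (f (2 ℕ.+ α) β) (F₂ α)
      at-n-1,m+1 = trans (value-at-point f {suc (suc k)} {suc m} {2 ℕ.+ α} {β} (cong suc distance) (cong suc midpoint))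
                         (cong (fr _) (F₂-fact α))

      at-n-2,m+2 : value f (suc k) (suc (suc m)) ≡ fr (prevcol f (2 ℕ.+ α) β) (F₂ α)
      at-n-2,m+2 = trans (value-at-prevcol f {suc k} {suc (suc m)} {2 ℕ.+ α} {β}
                                           (cong (λ u → suc (suc u)) distance) (cong (λ u → suc (suc u)) midpoint))
                         (cong (fr _) (F₂-fact α))

      at-n-3,m+1 : value f k (suc m) ≡ fr (prevcol f (suc α) β) (F₁ α)
      at-n-3,m+1 = trans (value-at-prevcol f {k} {suc m} {suc α} {β} (cong suc distance) (cong suc midpoint))
                         (cong (fr _) (fact-suc α))

      at-n-3,m-1 : value₋ f k m ≡ fr (f α β) (F₀ α)
      at-n-3,m-1 = value₋-at-point f f-vanishes {k} {m} {α} {β} distance midpoint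

      U-at : U (value f) (value₋ f) n m ≡ fr (Unum f α β) (Q α β)
      U-at = trans (Ushape-cong n≡N m≡M at-n-1,m-1 at-n-1,m+1 at-n-2,m+2 at-n-3,m+1 at-n-3,m-1)
                   (U-fraction α β _ _ _ _ _)

      top-at : value f n m ≡ fr (top f α β) (Q α β)
      top-at = trans at-n,m (fr-scale _ (F₂>0 α) β)

    module C = Points c c-above
    module C⁺ = Points c⁺ℤ c⁺ℤ-above

    L-at : Le n m ≡ Lshape N⟨ α , β ⟩ M⟨ α , β ⟩ (fr (c (suc α) (suc β)) (F₁ α)) (fr (c (2 ℕ.+ α) β) (F₂ α))
                                            (fr (prevcol c (2 ℕ.+ α) β) (F₂ α)) (fr (prevcol c (suc α) β) (F₁ α))
    L-at = trans (Le-values n m) (Lshape-cong n≡N m≡M C.at-n-1,m-1 C.at-n-1,m+1 C.at-n-2,m+2 C.at-n-3,m+1)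

    e≤Ue : e n m ℚ.≤ Ue n m
    e≤Ue = subst₂ ℚ._≤_ (sym C.top-at) (sym (trans (Ue-values n m) C.U-at))
                  (fr-mono-≤ (Q>0 α β) (top≤Unum α β β≤1+α))

    Ue≤Ud : Ue n m ℚ.≤ Ud n m
    Ue≤Ud = subst₂ ℚ._≤_ (sym (trans (Ue-values n m) C.U-at)) (sym (trans (Ud-values n m) C⁺.U-at))
                   (fr-mono-≤ (Q>0 α β) (Unum-mono c≤c⁺ α β))

    Ud≤d : Ud n m ℚ.≤ d n m
    Ud≤d = subst₂ ℚ._≤_ (sym (trans (Ud-values n m) C⁺.U-at)) (sym (trans (d-value n m) C⁺.top-at))
                  (fr-mono-≤ (Q>0 α β) (Unum≤top⁺ α β β≤1+α))

  even-lower : ∀ k m β α (distance : suc (suc (suc k)) ≡ m ℕ.+ (suc β ℕ.+ suc β)) (midpoint : m ℕ.+ β ≡ suc α) →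
    Le (suc (suc (suc k))) m ℚ.≤ e (suc (suc (suc k))) m
  even-lower k m zero α distance midpoint =
    subst₂ ℚ._≤_ (sym (trans L-at (L-fraction₀ α _ _ _ _))) (sym C.top-at)
           (fr-mono-≤ (Q>0 α 0) (Uhead≤top α))
    where open EvenCase k m zero α distance midpoint
  even-lower k m (suc γ) α distance midpoint =
    subst₂ ℚ._≤_ (sym (trans L-at (L-fraction α γ _ _ _ _)))
                 (sym (trans C.top-at (fr-scale _ (Q>0 α (suc γ)) γ)))
           (fr-mono-≤ (pos-* (Q>0 α (suc γ)) (γ , refl)) (lower≤top α γ (ℕP.≤-pred β≤1+α)))
    where open EvenCase k m (suc γ) α distance midpoint

  -- For n - m = 2(β+1) the midpoint (n+m)/2 is at least 2, since n ≥ 3.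
  even-case : ∀ k m β → suc (suc (suc k)) ≡ m ℕ.+ (suc β ℕ.+ suc β) → Goal (suc (suc (suc k))) m
  even-case k m β distance with m ℕ.+ β in midpoint
  ... | zero = ⊥-elim (ℕP.1+n≢0 (trans (halve k m β distance)
                         (cong₂ (λ a b → a ℕ.+ (b ℕ.+ b)) (ℕP.m+n≡0⇒m≡0 m midpoint) (ℕP.m+n≡0⇒n≡0 m midpoint))))
  ... | suc α = (even-lower k m β α distance midpoint , e≤Ue) , (Ue≤Ud , Ud≤d)
    where open EvenCase k m β α distance midpoint

open import Data.Nat using (ℕ; _≤_; _<_)
open import Data.Nat using (suc; zero; s≤s; z≤n)
import Data.Nat.Properties as ℕP
open import Data.Rational using (ℚ) renaming (_≤_ to _≤ℚ_)
open import Data.Product using (_×_)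
open import Data.Empty using (⊥-elim)
open import Relation.Binary.PropositionalEquality using (sym; trans)
open Values using (position; above; even; odd)
open Cases using (module OddCase; even-case)

lemma5p1 : (n m : ℕ) → 3 ≤ n → m < n →
    (Le n m ≤ℚ e n m × e n m ≤ℚ Ue n m) × (Ue n m ≤ℚ Ud n m × Ud n m ≤ℚ d n m)
lemma5p1 (suc (suc (suc k))) m (s≤s (s≤s (s≤s z≤n))) m<n with position (suc (suc (suc k))) m
... | above n<m = ⊥-elim (ℕP.<-asym n<m m<n)
... | even zero n≡m = ⊥-elim (ℕP.<⇒≢ m<n (sym (trans n≡m (ℕP.+-identityʳ m))))
... | even (suc β) distance = even-case k m β distance
... | odd j distance = OddCase.goal k m j distance
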